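{- Let $p\in\mathbb{N}$ and let $\phi$ be any one of the following first-order sentences in the language $\{R_1,R_2,R_3\}$ ($R_i(x,y)$ meaning $d(x,y)=i$): (1) any two distinct points are at distance $1$, $2$ or $3$; (2) no point is at distance $3$ from two distinct points; (3) for any three distinct points, either all three pairwise distances are $2$ or exactly one of them is $2$; (4) there exist points $u_1,\dots,u_p$ pairwise distinct and points $v_1,\dots,v_p$ pairwise distinct with $d(u_i,v_i)=3$ for all $i$; (5) there exist $2p$ pairwise distinct points $u_1,\dots,u_p,v_1,\dots,v_p$ such that for every $i$ and every point $w$ different from $u_i$ (resp. $v_i$), if $d(u_i,w)\ne 2$ then $d(u_i,w)=1$ (resp. if $d(v_i,w)\neq 2$ then $d(v_i,w)=1$). Let $\mathfrak{m}(n)$ be the proportion, among isometry classes of $n$-point spaces in $\mathcal{A}^3_{\infty,0,7,8}$, of those satisfying $\phi$. Then $\lim_{n\to\infty}\mathfrak{m}(n)=1$.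
   Context: $\mathcal{A}^3_{\infty,0,7,8}$ is the class of finite metric spaces, all of whose distances between distinct points lie in $\{1,2,3\}$, in which for every three distinct points the multiset of their pairwise distances is one of $\{1,1,2\}$, $\{1,2,3\}$, $\{2,2,2\}$. -}

module Defs where

open import Data.Nat using (ℕ; _+_; _≤_)
open import Data.Fin using (Fin)
open import Data.Fin.Permutation using (Permutation′; _⟨$⟩ʳ_)
open import Data.Product using (_×_; ∃-syntax; Σ-syntax)
open import Data.Sum using (_⊎_)
open import Data.List using (List)
open import Data.List.Relation.Unary.All using (All)
open import Data.List.Relation.Unary.Any using (Any)
open import Data.List.Relation.Unary.AllPairs using (AllPairs)
open import Relation.Binary.PropositionalEquality using (_≡_; _≢_)
open import Relation.Nullary using (¬_)
open import Function.Definitions using (Injective)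

Dist : ℕ → Set
Dist n = Fin n → Fin n → ℕ

MSet3 : ℕ → ℕ → ℕ → ℕ → ℕ → ℕ → Set
MSet3 a b c m1 m2 m3 =
    (a ≡ m1 × b ≡ m2 × c ≡ m3) ⊎ (a ≡ m1 × b ≡ m3 × c ≡ m2)
  ⊎ (a ≡ m2 × b ≡ m1 × c ≡ m3) ⊎ (a ≡ m2 × b ≡ m3 × c ≡ m1)
  ⊎ (a ≡ m3 × b ≡ m1 × c ≡ m2) ⊎ (a ≡ m3 × b ≡ m2 × c ≡ m1)

In123 : ℕ → Set
In123 a = a ≡ 1 ⊎ a ≡ 2 ⊎ a ≡ 3

IsMetric : ∀ {n} → Dist n → Set
IsMetric {n} d =
    (∀ x → d x x ≡ 0)
  × (∀ x y → x ≢ y → ¬ (d x y ≡ 0))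
  × (∀ x y → d x y ≡ d y x)
  × (∀ x y z → d x z ≤ d x y + d y z)

-- membership of (Fin n, d) in the class A^3_{∞,0,7,8}
InClass : ∀ {n} → Dist n → Set
InClass {n} d =
    IsMetric d
  × (∀ x y → x ≢ y → In123 (d x y))
  × (∀ x y z → x ≢ y → y ≢ z → x ≢ z →
       MSet3 (d x y) (d y z) (d x z) 1 1 2
     ⊎ MSet3 (d x y) (d y z) (d x z) 1 2 3
     ⊎ MSet3 (d x y) (d y z) (d x z) 2 2 2)

Isometric : ∀ {n} → Dist n → Dist n → Set
Isometric {n} d d' = Σ[ σ ∈ Permutation′ n ] (∀ x y → d' (σ ⟨$⟩ʳ x) (σ ⟨$⟩ʳ y) ≡ d x y)

Transversal : (n : ℕ) → List (Dist n) → Set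
Transversal n reps =
    All InClass reps
  × (∀ (d : Dist n) → InClass d → Any (Isometric d) reps)
  × AllPairs (λ d d' → ¬ Isometric d d') reps

ExactlyOne2 : ℕ → ℕ → ℕ → Set
ExactlyOne2 a b c =
    (a ≡ 2 × b ≢ 2 × c ≢ 2) ⊎ (a ≢ 2 × b ≡ 2 × c ≢ 2) ⊎ (a ≢ 2 × b ≢ 2 × c ≡ 2)

data Sentence : Set where
  φ1 φ2 φ3 φ4 φ5 : Sentence

Sat : ∀ {n} → (p : ℕ) → Sentence → Dist n → Set
Sat {n} p φ1 d = ∀ x y → x ≢ y → In123 (d x y)
Sat {n} p φ2 d = ∀ x y z → y ≢ z → ¬ (d x y ≡ 3 × d x z ≡ 3)
Sat {n} p φ3 d = ∀ x y z → x ≢ y → y ≢ z → x ≢ z →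
  (d x y ≡ 2 × d y z ≡ 2 × d x z ≡ 2) ⊎ ExactlyOne2 (d x y) (d y z) (d x z)
Sat {n} p φ4 d = ∃[ u ] ∃[ v ]
  (Injective _≡_ _≡_ u × Injective _≡_ _≡_ v × (∀ (i : Fin p) → d (u i) (v i) ≡ 3))
Sat {n} p φ5 d = ∃[ u ] ∃[ v ]
  ( Injective _≡_ _≡_ u × Injective _≡_ _≡_ v × (∀ (i j : Fin p) → u i ≢ v j)
  × (∀ i w → w ≢ u i → d (u i) w ≢ 2 → d (u i) w ≡ 1)
  × (∀ i w → w ≢ v i → d (v i) w ≢ 2 → d (v i) w ≡ 1))

-- A triangle of the class has even perimeter and at most one side of length 3, so in a space
-- of the class the parity of d(x, y) is side(x) xor side(y), where side(x) is the parity of the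
-- distance to a base point, and every point is at distance 3 from at most one other point.
-- Hence a space of the class is a 2-colouring together with a partial matching between the two
-- colours: distinct points are at distance 2 on the same side, 3 when matched, and 1 otherwise.
-- Its isometry class is therefore determined by the number m of matched pairs and the unordered
-- pair {a, b} of numbers of unmatched points on the two sides, with 2m + a + b = n.
-- Sentences (1)-(3) hold in every space of the class, (4) fails only when m < p and (5) only
-- when a + b < 2p, so at most p(n + 1) + (2p)² isometry classes fail the sentence, whereas the
-- shapes m, b < n/4, a = n - 2m - b already give (n/4)² isometry classes.

module Submission where

open import Defs
open import Algebra.Properties.CommutativeSemigroup using (interchange)
open import Data.Bool using (Bool; true; false; not; _∧_; _xor_; if_then_else_)
open import Data.Bool.Properties
  using (xor-assoc; xor-comm; xor-same; xor-identityʳ; ∧-conicalˡ; ∧-conicalʳ; not-involutive; ⇔→≡)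
open import Data.Empty using (⊥; ⊥-elim)
open import Data.Fin using (Fin; zero; suc; toℕ; fromℕ<; _≟_; combine; remQuot)
open import Data.Fin.Properties
  using (toℕ<n; toℕ-injective; injective⇒≤; any?; fromℕ<-injective; combine-injective; combine-remQuot)
open import Data.List using (List; []; _∷_; length; lookup)
open import Data.List.Membership.Propositional.Properties using (∈-lookup)
open import Data.List.Relation.Binary.Sublist.Propositional using (_⊆_; []; _∷_; _∷ʳ_)
open import Data.List.Relation.Binary.Sublist.Propositional.Properties using (All-resp-⊆)
open import Data.List.Relation.Unary.All as All using (All; []; _∷_)
open import Data.List.Relation.Unary.AllPairs using (AllPairs; []; _∷_)
open import Data.List.Relation.Unary.Any using (Any; index)
open import Data.List.Relation.Unary.Any.Properties using (lookup-index)
open import Data.Fin.Permutation using (permutation; _⟨$⟩ʳ_; _⟨$⟩ˡ_; inverseˡ; inverseʳ; flip; _∘ₚ_)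
open import Data.Nat using (ℕ; zero; suc; _+_; _*_; _∸_; _⊓_; _≤_; _<_; z≤n; s≤s; s≤s⁻¹)
open import Data.Nat.Properties
  using ( *-monoʳ-≤; *-monoˡ-≤; *-suc; +-assoc; +-cancelʳ-≡; +-cancelˡ-≡; +-comm; +-commutativeSemigroup
        ; +-mono-≤; +-monoʳ-<; +-monoˡ-<; +-monoˡ-≤; +-suc; <-cmp; <-≤-trans; <⇒≢; <⇒≤; ≤-<-trans
        ; m+[n∸m]≡n; m+n≤o⇒m≤o; m+n≤o⇒m≤o∸n; m≤m*n; m≤m+n; m≤n+m; m≤n⇒m⊓n≡m; m≥n⇒m⊓n≡n; m⊓n≤m+n
        ; ⊓-comm; suc-injective; ≤-antisym; ≤-refl; ≤-total; ≤-trans; ≰⇒>; module ≤-Reasoning )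
open import Data.Nat.DivMod using (_/_; _%_; m≡m%n+[m/n]*n; m%n<n; m*n/n≡m; m/n*n≤m; /-monoˡ-≤)
open import Data.Nat.Solver using (module +-*-Solver)
open import Data.Product using (_×_; _,_; proj₁; proj₂; map₁; map₂; uncurry; ∃; ∃-syntax)
open import Data.Sum using (_⊎_; inj₁; inj₂)
open import Function using (_∘_)
open import Function.Bundles using (mk⇔)
open import Relation.Binary.PropositionalEquality
open import Relation.Nullary using (¬_; Dec; yes; no; does)
open import Relation.Nullary.Decidable using (dec-true; dec-false)
open import Relation.Binary using (tri<; tri≈; tri>)

import Data.Nat.Properties as ℕ

indicator : Bool → ℕ
indicator true = 1
indicator false = 0

count : ∀ {n} → (Fin n → Bool) → ℕ
count {zero} P = 0
count {suc n} P = indicator (P zero) + count (P ∘ suc)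

count-cong : ∀ {n} {P Q : Fin n → Bool} → (∀ x → P x ≡ Q x) → count P ≡ count Q
count-cong {zero} eq = refl
count-cong {suc n} eq = cong₂ _+_ (cong indicator (eq zero)) (count-cong (eq ∘ suc))

count-true : ∀ n → count {n} (λ _ → true) ≡ n
count-true zero = refl
count-true (suc n) = cong suc (count-true n)

indicator-split : ∀ a b → indicator a ≡ indicator (a ∧ b) + indicator (a ∧ not b)
indicator-split true true = refl
indicator-split true false = refl
indicator-split false b = refl

count-split : ∀ {n} (P Q : Fin n → Bool) →
  count P ≡ count (λ x → P x ∧ Q x) + count (λ x → P x ∧ not (Q x))
count-split {zero} P Q = refl
count-split {suc n} P Q =
  trans (cong₂ _+_ (indicator-split (P zero) (Q zero)) (count-split (P ∘ suc) (Q ∘ suc)))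
        (interchange +-commutativeSemigroup (indicator (P zero ∧ Q zero))
          (indicator (P zero ∧ not (Q zero))) (count (λ x → P (suc x) ∧ Q (suc x)))
          (count (λ x → P (suc x) ∧ not (Q (suc x)))))

rank : ∀ {n} → (Fin n → Bool) → Fin n → ℕ
rank P zero = 0
rank P (suc x) = indicator (P zero) + rank (P ∘ suc) x

-- The k-th point satisfying P, counting from 0; a junk point when k ≥ count P.
select : ∀ {n} → (Fin (suc n) → Bool) → ℕ → Fin (suc n)
select {zero} P k = zero
select {suc n} P k with P zero | k
... | true | zero = zero
... | true | suc k′ = suc (select (P ∘ suc) k′)
... | false | _ = suc (select (P ∘ suc) k)

rank<count : ∀ {n} (P : Fin n → Bool) {x} → P x ≡ true → rank P x < count P
rank<count P {zero} Px rewrite Px = s≤s z≤n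
rank<count P {suc x} Px = +-monoʳ-< (indicator (P zero)) (rank<count (P ∘ suc) Px)

select-rank : ∀ {n} (P : Fin (suc n) → Bool) {x} → P x ≡ true → select P (rank P x) ≡ x
select-rank {zero} P {zero} Px = refl
select-rank {suc n} P {zero} Px rewrite Px = refl
select-rank {suc n} P {suc x} Px with P zero
... | true = cong suc (select-rank (P ∘ suc) Px)
... | false = cong suc (select-rank (P ∘ suc) Px)

select-holds : ∀ {n} (P : Fin (suc n) → Bool) {k} → k < count P → P (select P k) ≡ true
select-holds {zero} P k<c with P zero
... | true = refl
select-holds {zero} P () | false
select-holds {suc n} P {k} k<c with P zero in Pz | k
... | true | zero = Pz
... | true | suc k′ = select-holds (P ∘ suc) (s≤s⁻¹ k<c)
... | false | _ = select-holds (P ∘ suc) k<c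

rank-select : ∀ {n} (P : Fin (suc n) → Bool) {k} → k < count P → rank P (select P k) ≡ k
rank-select {zero} P {zero} k<c = refl
rank-select {zero} P {suc k} k<c with P zero
rank-select {zero} P {suc k} (s≤s ()) | true
rank-select {zero} P {suc k} () | false
rank-select {suc n} P {k} k<c with P zero in Pz | k
... | true | zero = refl
... | true | suc k′ rewrite Pz = cong suc (rank-select (P ∘ suc) (s≤s⁻¹ k<c))
... | false | _ rewrite Pz = rank-select (P ∘ suc) k<c

select-injective : ∀ {n} (P : Fin (suc n) → Bool) {k l} → k < count P → l < count P →
  select P k ≡ select P l → k ≡ l
select-injective P {k} {l} k<c l<c eq =
  trans (sym (rank-select P k<c)) (trans (cong (rank P) eq) (rank-select P l<c))

count-mono : ∀ {n} (P Q : Fin n → Bool) (f : Fin n → Fin n) →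
  (∀ x → P x ≡ true → Q (f x) ≡ true) →
  (∀ {x y} → P x ≡ true → P y ≡ true → f x ≡ f y → x ≡ y) →
  count P ≤ count Q
count-mono {zero} P Q f _ _ = z≤n
count-mono {suc n} P Q f preserves injective = injective⇒≤ g-injective
  where
  element : Fin (count P) → Fin (suc n)
  element i = select P (toℕ i)
  element-holds : ∀ i → P (element i) ≡ true
  element-holds i = select-holds P (toℕ<n i)
  g : Fin (count P) → Fin (count Q)
  g i = fromℕ< (rank<count Q (preserves _ (element-holds i)))
  g-injective : ∀ {i j} → g i ≡ g j → i ≡ j
  g-injective {i} {j} eq = toℕ-injective (select-injective P (toℕ<n i) (toℕ<n j) elements-equal)
    where
    ranks-equal : rank Q (f (element i)) ≡ rank Q (f (element j))
    ranks-equal = fromℕ<-injective _ _ _ _ eq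
    elements-equal : element i ≡ element j
    elements-equal = injective (element-holds i) (element-holds j)
      (trans (sym (select-rank Q (preserves _ (element-holds i))))
        (trans (cong (select Q) ranks-equal) (select-rank Q (preserves _ (element-holds j)))))

count-bijection : ∀ {n} (P Q : Fin n → Bool) (f g : Fin n → Fin n) →
  (∀ x → g (f x) ≡ x) → (∀ y → f (g y) ≡ y) → (∀ x → Q (f x) ≡ P x) →
  count P ≡ count Q
count-bijection P Q f g gf fg Qf≡P = ≤-antisym
  (count-mono P Q f (λ x Px → trans (Qf≡P x) Px) (λ _ _ → injective f g gf))
  (count-mono Q P g (λ y Qy → trans (sym (Qf≡P (g y))) (trans (cong Q (fg y)) Qy))
    (λ _ _ → injective g f fg))
  where
  injective : ∀ (h k : Fin _ → Fin _) → (∀ x → k (h x) ≡ x) → ∀ {x y} → h x ≡ h y → x ≡ y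
  injective h k kh {x} {y} eq = trans (sym (kh x)) (trans (cong k eq) (kh y))

-- Triangles of the class

odd : ℕ → Bool
odd zero = false
odd (suc n) = not (odd n)

data Triangle : ℕ → ℕ → ℕ → Set where
  t112 : Triangle 1 1 2
  t121 : Triangle 1 2 1
  t211 : Triangle 2 1 1
  t123 : Triangle 1 2 3
  t132 : Triangle 1 3 2
  t213 : Triangle 2 1 3
  t231 : Triangle 2 3 1
  t312 : Triangle 3 1 2
  t321 : Triangle 3 2 1
  t222 : Triangle 2 2 2

pattern is1 = inj₁ refl
pattern is2 = inj₂ (inj₁ refl)
pattern is3 = inj₂ (inj₂ refl)

ClassTriple : ℕ → ℕ → ℕ → Set
ClassTriple a b c = MSet3 a b c 1 1 2 ⊎ MSet3 a b c 1 2 3 ⊎ MSet3 a b c 2 2 2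

classTriple⇒triangle : ∀ {a b c} → ClassTriple a b c → Triangle a b c
classTriple⇒triangle (inj₁ m) = from112 m
  where
  from112 : ∀ {a b c} → MSet3 a b c 1 1 2 → Triangle a b c
  from112 (inj₁ (refl , refl , refl)) = t112
  from112 (inj₂ (inj₁ (refl , refl , refl))) = t121
  from112 (inj₂ (inj₂ (inj₁ (refl , refl , refl)))) = t112
  from112 (inj₂ (inj₂ (inj₂ (inj₁ (refl , refl , refl))))) = t121
  from112 (inj₂ (inj₂ (inj₂ (inj₂ (inj₁ (refl , refl , refl)))))) = t211
  from112 (inj₂ (inj₂ (inj₂ (inj₂ (inj₂ (refl , refl , refl)))))) = t211
classTriple⇒triangle (inj₂ (inj₁ m)) = from123 m
  where
  from123 : ∀ {a b c} → MSet3 a b c 1 2 3 → Triangle a b c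
  from123 (inj₁ (refl , refl , refl)) = t123
  from123 (inj₂ (inj₁ (refl , refl , refl))) = t132
  from123 (inj₂ (inj₂ (inj₁ (refl , refl , refl)))) = t213
  from123 (inj₂ (inj₂ (inj₂ (inj₁ (refl , refl , refl))))) = t231
  from123 (inj₂ (inj₂ (inj₂ (inj₂ (inj₁ (refl , refl , refl)))))) = t312
  from123 (inj₂ (inj₂ (inj₂ (inj₂ (inj₂ (refl , refl , refl)))))) = t321
classTriple⇒triangle (inj₂ (inj₂ m)) = from222 m
  where
  from222 : ∀ {a b c} → MSet3 a b c 2 2 2 → Triangle a b c
  from222 (inj₁ (refl , refl , refl)) = t222
  from222 (inj₂ (inj₁ (refl , refl , refl))) = t222
  from222 (inj₂ (inj₂ (inj₁ (refl , refl , refl)))) = t222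
  from222 (inj₂ (inj₂ (inj₂ (inj₁ (refl , refl , refl))))) = t222
  from222 (inj₂ (inj₂ (inj₂ (inj₂ (inj₁ (refl , refl , refl)))))) = t222
  from222 (inj₂ (inj₂ (inj₂ (inj₂ (inj₂ (refl , refl , refl)))))) = t222

triangle⇒classTriple : ∀ {a b c} → Triangle a b c → ClassTriple a b c
triangle⇒classTriple t112 = inj₁ (inj₁ (refl , refl , refl))
triangle⇒classTriple t121 = inj₁ (inj₂ (inj₁ (refl , refl , refl)))
triangle⇒classTriple t211 = inj₁ (inj₂ (inj₂ (inj₂ (inj₂ (inj₁ (refl , refl , refl))))))
triangle⇒classTriple t123 = inj₂ (inj₁ (inj₁ (refl , refl , refl)))
triangle⇒classTriple t132 = inj₂ (inj₁ (inj₂ (inj₁ (refl , refl , refl))))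
triangle⇒classTriple t213 = inj₂ (inj₁ (inj₂ (inj₂ (inj₁ (refl , refl , refl)))))
triangle⇒classTriple t231 = inj₂ (inj₁ (inj₂ (inj₂ (inj₂ (inj₁ (refl , refl , refl))))))
triangle⇒classTriple t312 = inj₂ (inj₁ (inj₂ (inj₂ (inj₂ (inj₂ (inj₁ (refl , refl , refl)))))))
triangle⇒classTriple t321 = inj₂ (inj₁ (inj₂ (inj₂ (inj₂ (inj₂ (inj₂ (refl , refl , refl)))))))
triangle⇒classTriple t222 = inj₂ (inj₂ (inj₁ (refl , refl , refl)))

triangle-odd : ∀ {a b c} → Triangle a b c → odd a xor odd b ≡ odd c
triangle-odd t112 = refl
triangle-odd t121 = refl
triangle-odd t211 = refl
triangle-odd t123 = refl
triangle-odd t132 = refl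
triangle-odd t213 = refl
triangle-odd t231 = refl
triangle-odd t312 = refl
triangle-odd t321 = refl
triangle-odd t222 = refl

triangle-≤ : ∀ {a b c} → Triangle a b c → c ≤ a + b
triangle-≤ t112 = s≤s (s≤s z≤n)
triangle-≤ t121 = s≤s z≤n
triangle-≤ t211 = s≤s z≤n
triangle-≤ t123 = s≤s (s≤s (s≤s z≤n))
triangle-≤ t132 = s≤s (s≤s z≤n)
triangle-≤ t213 = s≤s (s≤s (s≤s z≤n))
triangle-≤ t231 = s≤s z≤n
triangle-≤ t312 = s≤s (s≤s z≤n)
triangle-≤ t321 = s≤s z≤n
triangle-≤ t222 = s≤s (s≤s z≤n)

¬triangle-3-3 : ∀ {b} → ¬ Triangle 3 b 3
¬triangle-3-3 ()

triangle⇒φ3 : ∀ {a b c} → Triangle a b c → (a ≡ 2 × b ≡ 2 × c ≡ 2) ⊎ ExactlyOne2 a b c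
triangle⇒φ3 t112 = inj₂ (inj₂ (inj₂ ((λ ()) , (λ ()) , refl)))
triangle⇒φ3 t121 = inj₂ (inj₂ (inj₁ ((λ ()) , refl , (λ ()))))
triangle⇒φ3 t211 = inj₂ (inj₁ (refl , (λ ()) , (λ ())))
triangle⇒φ3 t123 = inj₂ (inj₂ (inj₁ ((λ ()) , refl , (λ ()))))
triangle⇒φ3 t132 = inj₂ (inj₂ (inj₂ ((λ ()) , (λ ()) , refl)))
triangle⇒φ3 t213 = inj₂ (inj₁ (refl , (λ ()) , (λ ())))
triangle⇒φ3 t231 = inj₂ (inj₁ (refl , (λ ()) , (λ ())))
triangle⇒φ3 t312 = inj₂ (inj₂ (inj₂ ((λ ()) , (λ ()) , refl)))
triangle⇒φ3 t321 = inj₂ (inj₂ (inj₁ ((λ ()) , refl , (λ ()))))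
triangle⇒φ3 t222 = inj₁ (refl , refl , refl)

triangle-intro : ∀ {a b c} → In123 a → In123 b → In123 c → odd a xor odd b ≡ odd c →
  ¬ (a ≡ 3 × b ≡ 3) → ¬ (b ≡ 3 × c ≡ 3) → ¬ (a ≡ 3 × c ≡ 3) → Triangle a b c
triangle-intro is1 is1 is1 () _ _ _
triangle-intro is1 is1 is2 _ _ _ _ = t112
triangle-intro is1 is1 is3 () _ _ _
triangle-intro is1 is2 is1 _ _ _ _ = t121
triangle-intro is1 is2 is2 () _ _ _
triangle-intro is1 is2 is3 _ _ _ _ = t123
triangle-intro is1 is3 is1 () _ _ _
triangle-intro is1 is3 is2 _ _ _ _ = t132
triangle-intro is1 is3 is3 () _ _ _
triangle-intro is2 is1 is1 _ _ _ _ = t211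
triangle-intro is2 is1 is2 () _ _ _
triangle-intro is2 is1 is3 _ _ _ _ = t213
triangle-intro is2 is2 is1 () _ _ _
triangle-intro is2 is2 is2 _ _ _ _ = t222
triangle-intro is2 is2 is3 () _ _ _
triangle-intro is2 is3 is1 _ _ _ _ = t231
triangle-intro is2 is3 is2 () _ _ _
triangle-intro is2 is3 is3 _ _ no33 _ = ⊥-elim (no33 (refl , refl))
triangle-intro is3 is1 is1 () _ _ _
triangle-intro is3 is1 is2 _ _ _ _ = t312
triangle-intro is3 is1 is3 _ _ _ no33 = ⊥-elim (no33 (refl , refl))
triangle-intro is3 is2 is1 _ _ _ _ = t321
triangle-intro is3 is2 is2 () _ _ _
triangle-intro is3 is2 is3 _ _ _ no33 = ⊥-elim (no33 (refl , refl))
triangle-intro is3 is3 is1 () _ _ _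
triangle-intro is3 is3 is2 _ no33 _ _ = ⊥-elim (no33 (refl , refl))
triangle-intro is3 is3 is3 () _ _ _

inClass-intro : ∀ {n} {d : Dist n} → (∀ x → d x x ≡ 0) → (∀ x y → d x y ≡ d y x) →
  (∀ x y → x ≢ y → In123 (d x y)) →
  (∀ x y z → x ≢ y → y ≢ z → x ≢ z → Triangle (d x y) (d y z) (d x z)) → InClass d
inClass-intro {d = d} diag sym in123 triangle =
  (diag , (λ x y x≢y → nonzero (in123 x y x≢y)) , sym , triangle-inequality) ,
  in123 , (λ x y z x≢y y≢z x≢z → triangle⇒classTriple (triangle x y z x≢y y≢z x≢z))
  where
  nonzero : ∀ {a} → In123 a → a ≢ 0
  nonzero is1 ()
  nonzero is2 ()
  nonzero is3 ()
  triangle-inequality : ∀ x y z → d x z ≤ d x y + d y z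
  triangle-inequality x y z with x ≟ z | x ≟ y | y ≟ z
  ... | yes refl | _ | _ rewrite diag x = z≤n
  ... | no _ | yes refl | _ rewrite diag x = ≤-refl
  ... | no _ | no _ | yes refl rewrite diag y = m≤m+n (d x y) 0
  ... | no x≢z | no x≢y | no y≢z = triangle-≤ (triangle x y z x≢y y≢z x≢z)

-- Structures: sides and partners

-- Boolean equality by recursion on the first argument, so that true ≐ b and false ≐ b reduce.
_≐_ : Bool → Bool → Bool
true ≐ b = b
false ≐ b = not b

≐-refl : ∀ a → a ≐ a ≡ true
≐-refl true = refl
≐-refl false = refl

≐⇒≡ : ∀ a b → a ≐ b ≡ true → b ≡ a
≐⇒≡ true true _ = refl
≐⇒≡ false false _ = refl

≐-not : ∀ a b → a ≐ not b ≡ not a ≐ b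
≐-not true b = refl
≐-not false b = not-involutive b

xor-cancelˡ : ∀ a b → a xor (a xor b) ≡ b
xor-cancelˡ a b = trans (sym (xor-assoc a a b)) (cong (_xor b) (xor-same a))

xor-cancel-middle : ∀ a b c → (a xor b) xor (b xor c) ≡ a xor c
xor-cancel-middle a b c = trans (xor-assoc a b (b xor c)) (cong (a xor_) (xor-cancelˡ b c))

xor≡true : ∀ a b → a xor b ≡ true → b ≡ not a
xor≡true true false _ = refl
xor≡true false true _ = refl

xor-flip : ∀ c a b → (c xor a) xor (c xor b) ≡ a xor b
xor-flip c a b = trans (cong (_xor (c xor b)) (xor-comm c a)) (xor-cancel-middle a c b)

xor-transport : ∀ a b a′ b′ → a′ xor b′ ≡ a xor b → a′ ≡ (b xor b′) xor a
xor-transport a b a′ b′ eq = begin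
  a′                ≡⟨ sym (trans (cong (a′ xor_) (xor-same b′)) (xor-identityʳ a′)) ⟩
  a′ xor (b′ xor b′) ≡⟨ sym (xor-assoc a′ b′ b′) ⟩
  (a′ xor b′) xor b′ ≡⟨ cong (_xor b′) eq ⟩
  (a xor b) xor b′   ≡⟨ xor-assoc a b b′ ⟩
  a xor (b xor b′)   ≡⟨ xor-comm a (b xor b′) ⟩
  (b xor b′) xor a   ∎
  where open ≡-Reasoning

witness : ∀ {P : Set} (P? : Dec P) → does P? ≡ true → P
witness (yes p) _ = p

record Structure (n : ℕ) : Set where
  field
    side : Fin n → Bool
    partner : Fin n → Fin n
    partner-involutive : ∀ x → partner (partner x) ≡ x
    partner-crosses : ∀ x → partner x ≢ x → side x xor side (partner x) ≡ true

  matched : Fin n → Bool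
  matched x = not (does (partner x ≟ x))

link : (opposite partnered : Bool) → ℕ
link false _ = 2
link true true = 3
link true false = 1

distance : ∀ {n} → Structure n → Dist n
distance S x y =
  if does (x ≟ y) then 0 else link (side x xor side y) (does (partner x ≟ y))
  where open Structure S

link-odd : ∀ c m → odd (link c m) ≡ c
link-odd false _ = refl
link-odd true true = refl
link-odd true false = refl

link-In123 : ∀ c m → In123 (link c m)
link-In123 false _ = is2
link-In123 true true = is3
link-In123 true false = is1

link≡3 : ∀ c m → link c m ≡ 3 → m ≡ true
link≡3 true true _ = refl

module DistanceProperties {n : ℕ} (S : Structure n) where
  open Structure S

  distance-diag : ∀ x → distance S x x ≡ 0
  distance-diag x rewrite dec-true (x ≟ x) refl = refl

  distance-off : ∀ {x y} → x ≢ y →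
    distance S x y ≡ link (side x xor side y) (does (partner x ≟ y))
  distance-off {x} {y} x≢y rewrite dec-false (x ≟ y) x≢y = refl

  partner-swap : ∀ {x y} → partner x ≡ y → partner y ≡ x
  partner-swap {x} refl = partner-involutive x

  partner-injective : ∀ {x y} → partner x ≡ partner y → x ≡ y
  partner-injective {x} {y} eq =
    trans (sym (partner-involutive x)) (trans (cong partner eq) (partner-involutive y))

  partner-sym : ∀ x y → does (partner x ≟ y) ≡ does (partner y ≟ x)
  partner-sym x y with partner x ≟ y | partner y ≟ x
  ... | yes _ | yes _ = refl
  ... | no _ | no _ = refl
  ... | yes px≡y | no py≢x = ⊥-elim (py≢x (partner-swap px≡y))
  ... | no px≢y | yes py≡x = ⊥-elim (px≢y (partner-swap py≡x))

  distance-sym : ∀ x y → distance S x y ≡ distance S y x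
  distance-sym x y with x ≟ y
  ... | yes refl = sym (distance-diag x)
  ... | no x≢y = trans (cong₂ link (xor-comm (side x) (side y)) (partner-sym x y))
                       (sym (distance-off (x≢y ∘ sym)))

  odd-distance : ∀ x y → odd (distance S x y) ≡ side x xor side y
  odd-distance x y with x ≟ y
  ... | yes refl = sym (xor-same (side x))
  ... | no x≢y = link-odd _ _

  distance-In123 : ∀ x y → x ≢ y → In123 (distance S x y)
  distance-In123 x y x≢y rewrite distance-off x≢y = link-In123 _ _

  three⇒partner : ∀ {x y} → distance S x y ≡ 3 → partner x ≡ y
  three⇒partner {x} {y} d≡3 with x ≟ y
  three⇒partner () | yes refl
  ... | no x≢y = witness (partner x ≟ y) (link≡3 _ _ d≡3)

  three⇒distinct : ∀ {x y} → distance S x y ≡ 3 → x ≢ y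
  three⇒distinct {x} dxy≡3 refl with trans (sym (distance-diag x)) dxy≡3
  ... | ()

  partner-three : ∀ x → partner x ≢ x → distance S x (partner x) ≡ 3
  partner-three x px≢x
    rewrite distance-off (px≢x ∘ sym) | partner-crosses x px≢x | dec-true (partner x ≟ partner x) refl
    = refl

  distance-triangle : ∀ x y z → x ≢ y → y ≢ z → x ≢ z →
    Triangle (distance S x y) (distance S y z) (distance S x z)
  distance-triangle x y z x≢y y≢z x≢z =
    triangle-intro (distance-In123 x y x≢y) (distance-In123 y z y≢z) (distance-In123 x z x≢z)
      odd-additive no-xy-yz no-yz-xz no-xy-xz
    where
    odd-additive : odd (distance S x y) xor odd (distance S y z) ≡ odd (distance S x z)
    odd-additive rewrite odd-distance x y | odd-distance y z | odd-distance x z =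
      xor-cancel-middle (side x) (side y) (side z)
    no-xy-yz : ¬ (distance S x y ≡ 3 × distance S y z ≡ 3)
    no-xy-yz (xy , yz) =
      x≢z (trans (sym (partner-swap (three⇒partner xy))) (three⇒partner yz))
    no-yz-xz : ¬ (distance S y z ≡ 3 × distance S x z ≡ 3)
    no-yz-xz (yz , xz) =
      x≢y (trans (sym (partner-swap (three⇒partner xz))) (partner-swap (three⇒partner yz)))
    no-xy-xz : ¬ (distance S x y ≡ 3 × distance S x z ≡ 3)
    no-xy-xz (xy , xz) = y≢z (trans (sym (three⇒partner xy)) (three⇒partner xz))

  distance-inClass : InClass (distance S)
  distance-inClass = inClass-intro distance-diag distance-sym distance-In123 distance-triangle

link-recover : ∀ {a} m → In123 a → (m ≡ true → a ≡ 3) → (a ≡ 3 → m ≡ true) → a ≡ link (odd a) m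
link-recover true is1 to3 _ with to3 refl
... | ()
link-recover false is1 _ _ = refl
link-recover _ is2 _ _ = refl
link-recover true is3 _ _ = refl
link-recover false is3 _ from3 with from3 refl
... | ()

-- Spaces of the class are structures

module FromClass {n : ℕ} (d : Dist (suc n)) (C : InClass d) where

  d-diag : ∀ x → d x x ≡ 0
  d-diag = proj₁ (proj₁ C)

  d-sym : ∀ x y → d x y ≡ d y x
  d-sym = proj₁ (proj₂ (proj₂ (proj₁ C)))

  d-In123 : ∀ x y → x ≢ y → In123 (d x y)
  d-In123 = proj₁ (proj₂ C)

  d-triangle : ∀ x y z → x ≢ y → y ≢ z → x ≢ z → Triangle (d x y) (d y z) (d x z)
  d-triangle x y z x≢y y≢z x≢z = classTriple⇒triangle (proj₂ (proj₂ C) x y z x≢y y≢z x≢z)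

  odd-additive : ∀ x y z → odd (d x y) xor odd (d y z) ≡ odd (d x z)
  odd-additive x y z with x ≟ y | y ≟ z | x ≟ z
  ... | yes refl | _ | _ rewrite d-diag x = refl
  ... | no _ | yes refl | _ rewrite d-diag y = xor-identityʳ _
  ... | no _ | no _ | yes refl rewrite d-diag x | d-sym y x = xor-same (odd (d x y))
  ... | no x≢y | no y≢z | no x≢z = triangle-odd (d-triangle x y z x≢y y≢z x≢z)

  side : Fin (suc n) → Bool
  side x = odd (d zero x)

  odd-d : ∀ x y → odd (d x y) ≡ side x xor side y
  odd-d x y =
    trans (sym (xor-cancelˡ (side x) (odd (d x y)))) (cong (side x xor_) (odd-additive zero x y))

  three⇒≢ : ∀ {x y} → d x y ≡ 3 → x ≢ y
  three⇒≢ {x} dxy≡3 refl with trans (sym dxy≡3) (d-diag x)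
  ... | ()

  no-two-threes : ∀ {x y z} → y ≢ z → d x y ≡ 3 → d x z ≡ 3 → ⊥
  no-two-threes {x} {y} {z} y≢z dxy≡3 dxz≡3 = ¬triangle-3-3
    (subst₂ (λ a c → Triangle a (d y z) c) dxy≡3 dxz≡3
      (d-triangle x y z (three⇒≢ dxy≡3) y≢z (three⇒≢ dxz≡3)))

  choosePartner : ∀ x → Dec (∃ λ y → d x y ≡ 3) → Fin (suc n)
  choosePartner x (yes (y , _)) = y
  choosePartner x (no _) = x

  choosePartner-unique : ∀ {x y} (found : Dec (∃ λ y → d x y ≡ 3)) → d x y ≡ 3 →
    choosePartner x found ≡ y
  choosePartner-unique {y = y} (yes (y′ , dxy′≡3)) dxy≡3 with y′ ≟ y
  ... | yes y′≡y = y′≡y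
  ... | no y′≢y = ⊥-elim (no-two-threes y′≢y dxy′≡3 dxy≡3)
  choosePartner-unique (no none) dxy≡3 = ⊥-elim (none (_ , dxy≡3))

  choosePartner-three : ∀ {x} (found : Dec (∃ λ y → d x y ≡ 3)) →
    choosePartner x found ≢ x → d x (choosePartner x found) ≡ 3
  choosePartner-three (yes (_ , dxy≡3)) _ = dxy≡3
  choosePartner-three (no _) px≢x = ⊥-elim (px≢x refl)

  partner : Fin (suc n) → Fin (suc n)
  partner x = choosePartner x (any? (λ y → d x y ℕ.≟ 3))

  three⇒partner : ∀ {x y} → d x y ≡ 3 → partner x ≡ y
  three⇒partner {x} = choosePartner-unique (any? (λ y → d x y ℕ.≟ 3))

  partner-three : ∀ x → partner x ≢ x → d x (partner x) ≡ 3
  partner-three x = choosePartner-three (any? (λ y → d x y ℕ.≟ 3))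

  partner-involutive : ∀ x → partner (partner x) ≡ x
  partner-involutive x with partner x ≟ x
  ... | yes px≡x = trans (cong partner px≡x) px≡x
  ... | no px≢x = three⇒partner (trans (d-sym (partner x) x) (partner-three x px≢x))

  structure : Structure (suc n)
  structure = record
    { side = side
    ; partner = partner
    ; partner-involutive = partner-involutive
    ; partner-crosses = λ x px≢x → trans (sym (odd-d x (partner x))) (cong odd (partner-three x px≢x))
    }

  d≗distance : ∀ x y → d x y ≡ distance structure x y
  d≗distance x y with x ≟ y
  ... | yes refl = d-diag x
  ... | no x≢y = trans (link-recover (does (partner x ≟ y)) (d-In123 x y x≢y) to3 from3)
                       (cong (λ c → link c (does (partner x ≟ y))) (odd-d x y))
    where
    to3 : does (partner x ≟ y) ≡ true → d x y ≡ 3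
    to3 px≟y with witness (partner x ≟ y) px≟y
    ... | refl = partner-three x (λ px≡x → x≢y (sym px≡x))
    from3 : d x y ≡ 3 → does (partner x ≟ y) ≡ true
    from3 dxy≡3 = dec-true (partner x ≟ y) (three⇒partner dxy≡3)

ofKind : ∀ {n} → Structure n → Bool → Bool → Fin n → Bool
ofKind S m s x = (m ≐ Structure.matched S x) ∧ (s ≐ Structure.side S x)

kindCount : ∀ {n} → Structure n → Bool → Bool → ℕ
kindCount S m s = count (ofKind S m s)

pairs unmatched smallerSide : ∀ {n} → Structure n → ℕ
pairs S = kindCount S true true
unmatched S = kindCount S false true + kindCount S false false
smallerSide S = kindCount S false true ⊓ kindCount S false false

module KindProperties {n : ℕ} (S : Structure n) where
  open Structure S
  open DistanceProperties S

  ofKind-sound : ∀ m s x → ofKind S m s x ≡ true → matched x ≡ m × side x ≡ s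
  ofKind-sound m s x holds =
    ≐⇒≡ m (matched x) (∧-conicalˡ _ _ holds) , ≐⇒≡ s (side x) (∧-conicalʳ _ _ holds)

  ofKind-complete : ∀ {m s x} → matched x ≡ m → side x ≡ s → ofKind S m s x ≡ true
  ofKind-complete {m} {s} refl refl = cong₂ _∧_ (≐-refl m) (≐-refl s)

  matched⇒moved : ∀ {x} → matched x ≡ true → partner x ≢ x
  matched⇒moved {x} mx px≡x rewrite dec-true (partner x ≟ x) px≡x with mx
  ... | ()

  unmatched⇒fixed : ∀ {x} → matched x ≡ false → partner x ≡ x
  unmatched⇒fixed {x} mx with partner x ≟ x
  ... | yes px≡x = px≡x

  matched-partner : ∀ x → matched (partner x) ≡ matched x
  matched-partner x with partner x ≟ x | partner (partner x) ≟ partner x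
  ... | yes _ | yes _ = refl
  ... | no _ | no _ = refl
  ... | yes px≡x | no ppx≢px = ⊥-elim (ppx≢px (cong partner px≡x))
  ... | no px≢x | yes ppx≡px = ⊥-elim (px≢x (trans (sym ppx≡px) (partner-involutive x)))

  side-partner : ∀ {x} → matched x ≡ true → side (partner x) ≡ not (side x)
  side-partner {x} mx = xor≡true _ _ (partner-crosses x (matched⇒moved mx))

  three⇒matched : ∀ x y → distance S x y ≡ 3 → matched x ≡ true
  three⇒matched x y dxy≡3 = cong not (dec-false (partner x ≟ x) moved)
    where
    moved : partner x ≢ x
    moved px≡x = three⇒distinct dxy≡3 (trans (sym px≡x) (three⇒partner dxy≡3))

  matched⇒three : ∀ x → matched x ≡ true → distance S x (partner x) ≡ 3
  matched⇒three x mx = partner-three x (matched⇒moved mx)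

  pairs-balanced : kindCount S true false ≡ pairs S
  pairs-balanced = count-bijection _ _ partner partner partner-involutive partner-involutive swap
    where
    swap : ∀ x → ofKind S true true (partner x) ≡ ofKind S true false x
    swap x with matched x in mx
    ... | true rewrite matched-partner x | mx | side-partner mx = refl
    ... | false rewrite unmatched⇒fixed mx | mx = refl

  size : n ≡ pairs S + pairs S + unmatched S
  size = begin
    n                                          ≡⟨ count-true n ⟨
    count {n} (λ _ → true)                     ≡⟨ count-split (λ _ → true) matched ⟩
    count matched + count (not ∘ matched)
      ≡⟨ cong₂ _+_ (count-split matched side) (count-split (not ∘ matched) side) ⟩
    pairs S + kindCount S true false + unmatched S
      ≡⟨ cong (λ k → pairs S + k + unmatched S) pairs-balanced ⟩
    pairs S + pairs S + unmatched S            ∎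
    where open ≡-Reasoning

  unmatched-distance : ∀ {x w} → matched x ≡ false → w ≢ x → distance S x w ≢ 2 →
    distance S x w ≡ 1
  unmatched-distance {x} {w} mx w≢x d≢2
    rewrite distance-off (w≢x ∘ sym) | unmatched⇒fixed mx | dec-false (x ≟ w) (w≢x ∘ sym)
    with side x xor side w
  ... | true = refl
  ... | false = ⊥-elim (d≢2 refl)

  count-unmatched : count (not ∘ matched) ≡ unmatched S
  count-unmatched = count-split (not ∘ matched) side

  smallerSide<size : smallerSide S < suc n
  smallerSide<size = s≤s (≤-trans (m⊓n≤m+n _ _)
    (subst (unmatched S ≤_) (sym size) (m≤n+m (unmatched S) (pairs S + pairs S))))

SameKindCounts : ∀ {n} → Structure n → Structure n → Set
SameKindCounts S U = ∀ m s → kindCount S m s ≡ kindCount U m s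

SameShape : ∀ {n} → Structure n → Structure n → Set
SameShape S U = pairs S ≡ pairs U × unmatched S ≡ unmatched U × smallerSide S ≡ smallerSide U

flipSides : ∀ {n} → Bool → Structure n → Structure n
flipSides c S = record
  { side = λ x → c xor side x
  ; partner = partner
  ; partner-involutive = partner-involutive
  ; partner-crosses = λ x px≢x → trans (xor-flip c (side x) (side (partner x))) (partner-crosses x px≢x)
  }
  where open Structure S

distance-flipSides : ∀ {n} c (S : Structure n) x y → distance (flipSides c S) x y ≡ distance S x y
distance-flipSides c S x y =
  cong (λ e → if does (x ≟ y) then 0 else link e (does (partner x ≟ y))) (xor-flip c (side x) (side y))
  where open Structure S

kindCount-flipSides : ∀ {n} (S : Structure n) m s →
  kindCount (flipSides true S) m s ≡ kindCount S m (not s)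
kindCount-flipSides S m s =
  count-cong λ x → cong ((m ≐ Structure.matched S x) ∧_) (≐-not s (Structure.side S x))

⊓-+-unordered : ∀ a b a′ b′ → a ⊓ b ≡ a′ ⊓ b′ → a + b ≡ a′ + b′ →
  (a ≡ a′ × b ≡ b′) ⊎ (a ≡ b′ × b ≡ a′)
⊓-+-unordered a b a′ b′ min≡ sum≡ with ≤-total a b | ≤-total a′ b′
... | inj₁ a≤b | inj₁ a′≤b′ = inj₁ (a≡a′ , +-cancelˡ-≡ a b b′ (trans sum≡ (cong (_+ b′) (sym a≡a′))))
  where
  a≡a′ : a ≡ a′
  a≡a′ = trans (sym (m≤n⇒m⊓n≡m a≤b)) (trans min≡ (m≤n⇒m⊓n≡m a′≤b′))
... | inj₁ a≤b | inj₂ b′≤a′ =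
  inj₂ (a≡b′ , +-cancelˡ-≡ a b a′ (trans sum≡ (trans (+-comm a′ b′) (cong (_+ a′) (sym a≡b′)))))
  where
  a≡b′ : a ≡ b′
  a≡b′ = trans (sym (m≤n⇒m⊓n≡m a≤b)) (trans min≡ (m≥n⇒m⊓n≡n b′≤a′))
... | inj₂ b≤a | inj₁ a′≤b′ =
  inj₂ (+-cancelʳ-≡ b a b′ (trans sum≡ (trans (+-comm a′ b′) (cong (b′ +_) (sym b≡a′)))) , b≡a′)
  where
  b≡a′ : b ≡ a′
  b≡a′ = trans (sym (m≥n⇒m⊓n≡n b≤a)) (trans min≡ (m≤n⇒m⊓n≡m a′≤b′))
... | inj₂ b≤a | inj₂ b′≤a′ = inj₁ (+-cancelʳ-≡ b a a′ (trans sum≡ (cong (a′ +_) (sym b≡b′))) , b≡b′)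
  where
  b≡b′ : b ≡ b′
  b≡b′ = trans (sym (m≥n⇒m⊓n≡n b≤a)) (trans min≡ (m≥n⇒m⊓n≡n b′≤a′))

module _ {n : ℕ} {S U : Structure n} where
  private
    module S = KindProperties S
    module U = KindProperties U

  sameKindCounts⇒sameShape : ∀ c → SameKindCounts (flipSides c S) U → SameShape S U
  sameKindCounts⇒sameShape false same =
    same true true , cong₂ _+_ (same false true) (same false false) ,
    cong₂ _⊓_ (same false true) (same false false)
  sameKindCounts⇒sameShape true same =
    trans (sym S.pairs-balanced) (flipped true true) ,
    trans (+-comm (kindCount S false true) _) (cong₂ _+_ (flipped false true) (flipped false false)) ,
    trans (⊓-comm (kindCount S false true) _) (cong₂ _⊓_ (flipped false true) (flipped false false))
    where
    flipped : ∀ m s → kindCount S m (not s) ≡ kindCount U m s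
    flipped m s = trans (sym (kindCount-flipSides S m s)) (same m s)

  sameShape⇒sameKindCounts : SameShape S U → ∃[ c ] SameKindCounts (flipSides c S) U
  sameShape⇒sameKindCounts (pairs≡ , unmatched≡ , smaller≡)
    with ⊓-+-unordered _ _ _ _ smaller≡ unmatched≡
  ... | inj₁ (a≡a′ , b≡b′) = false , same
    where
    same : SameKindCounts S U
    same true true = pairs≡
    same true false = trans S.pairs-balanced (trans pairs≡ (sym U.pairs-balanced))
    same false true = a≡a′
    same false false = b≡b′
  ... | inj₂ (a≡b′ , b≡a′) = true , λ m s → trans (kindCount-flipSides S m s) (swapped m s)
    where
    swapped : ∀ m s → kindCount S m (not s) ≡ kindCount U m s
    swapped true true = trans S.pairs-balanced pairs≡
    swapped true false = trans pairs≡ (sym U.pairs-balanced)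
    swapped false true = b≡a′
    swapped false false = a≡b′

double-injective : ∀ m n → m + m ≡ n + n → m ≡ n
double-injective zero zero _ = refl
double-injective (suc m) (suc n) eq = cong suc (double-injective m n
  (suc-injective (trans (sym (+-suc m m)) (trans (suc-injective eq) (+-suc n n)))))

module _ {n : ℕ} {S U : Structure n} where
  private
    module S = KindProperties S
    module U = KindProperties U

  sameShape-fromPairs : pairs S ≡ pairs U → smallerSide S ≡ smallerSide U → SameShape S U
  sameShape-fromPairs pairs≡ smaller≡ = pairs≡ ,
    +-cancelˡ-≡ (pairs U + pairs U) _ _
      (trans (cong (λ k → k + k + unmatched S) (sym pairs≡)) (trans (sym S.size) U.size)) ,
    smaller≡

  sameShape-fromUnmatched : unmatched S ≡ unmatched U → smallerSide S ≡ smallerSide U → SameShape S U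
  sameShape-fromUnmatched unmatched≡ smaller≡ =
    double-injective _ _ (+-cancelʳ-≡ _ (pairs S + pairs S) (pairs U + pairs U)
      (trans (sym S.size) (trans U.size (cong (pairs U + pairs U +_) (sym unmatched≡))))) ,
    unmatched≡ , smaller≡

-- Isometries and shapes

Isometric-resp : ∀ {n} {d₁ d₂ e₁ e₂ : Dist n} → (∀ x y → d₁ x y ≡ d₂ x y) →
  (∀ x y → e₁ x y ≡ e₂ x y) → Isometric d₁ e₁ → Isometric d₂ e₂
Isometric-resp d₁≗d₂ e₁≗e₂ (π , preserves) =
  π , λ x y → trans (sym (e₁≗e₂ _ _)) (trans (preserves x y) (d₁≗d₂ x y))

Isometric-sym : ∀ {n} {d d′ : Dist n} → Isometric d d′ → Isometric d′ d
Isometric-sym {d = d} {d′} (π , preserves) = flip π , λ x y →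
  trans (sym (preserves (π ⟨$⟩ˡ x) (π ⟨$⟩ˡ y))) (cong₂ d′ (inverseʳ π) (inverseʳ π))

Isometric-trans : ∀ {n} {d d′ d″ : Dist n} → Isometric d d′ → Isometric d′ d″ → Isometric d d″
Isometric-trans (π , π-preserves) (ρ , ρ-preserves) =
  π ∘ₚ ρ , λ x y → trans (ρ-preserves _ _) (π-preserves x y)

does-injective : ∀ {n} (f : Fin n → Fin n) → (∀ {x y} → f x ≡ f y → x ≡ y) →
  ∀ x y → does (f x ≟ f y) ≡ does (x ≟ y)
does-injective f injective x y with f x ≟ f y | x ≟ y
... | yes _ | yes _ = refl
... | no _ | no _ = refl
... | yes fx≡fy | no x≢y = ⊥-elim (x≢y (injective fx≡fy))
... | no fx≢fy | yes x≡y = ⊥-elim (fx≢fy (cong f x≡y))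

distance-preserved : ∀ {n} (S U : Structure n) (f : Fin n → Fin n) → (∀ {x y} → f x ≡ f y → x ≡ y) →
  (∀ x → Structure.side U (f x) ≡ Structure.side S x) →
  (∀ x → Structure.partner U (f x) ≡ f (Structure.partner S x)) →
  ∀ x y → distance U (f x) (f y) ≡ distance S x y
distance-preserved S U f injective side-f partner-f x y
  rewrite does-injective f injective x y | side-f x | side-f y | partner-f x
        | does-injective f injective (Structure.partner S x) y = refl

transfer : ∀ {n} (S U : Structure (suc n)) → Bool → Bool → Fin (suc n) → Fin (suc n)
transfer S U m s x = select (ofKind U m s) (rank (ofKind S m s) x)

-- Points are sent kind by kind to the point of equal rank, except that a matched point on side
-- false goes to the partner of the image of its partner, so that partners are preserved.
relabelBy : ∀ {n} (S U : Structure (suc n)) → Bool → Bool → Fin (suc n) → Fin (suc n)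
relabelBy S U true false x =
  Structure.partner U (transfer S U true true (Structure.partner S x))
relabelBy S U true true x = transfer S U true true x
relabelBy S U false s x = transfer S U false s x

relabel : ∀ {n} (S U : Structure (suc n)) → Fin (suc n) → Fin (suc n)
relabel S U x = relabelBy S U (Structure.matched S x) (Structure.side S x) x

module Relabel {n : ℕ} (S U : Structure (suc n)) (same : SameKindCounts S U) where
  private
    module S where
      open Structure S public
      open KindProperties S public
    module U where
      open Structure U public
      open KindProperties U public
      open DistanceProperties U public

  rank<kindCount : ∀ m s x → ofKind S m s x ≡ true → rank (ofKind S m s) x < kindCount U m s
  rank<kindCount m s x holds =
    subst (rank (ofKind S m s) x <_) (same m s) (rank<count (ofKind S m s) holds)

  transfer-kind : ∀ m s x → ofKind S m s x ≡ true → ofKind U m s (transfer S U m s x) ≡ true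
  transfer-kind m s x holds = select-holds (ofKind U m s) (rank<kindCount m s x holds)

  transfer-inverse : ∀ m s x → ofKind S m s x ≡ true → transfer U S m s (transfer S U m s x) ≡ x
  transfer-inverse m s x holds =
    trans (cong (select (ofKind S m s)) (rank-select (ofKind U m s) (rank<kindCount m s x holds)))
          (select-rank (ofKind S m s) holds)

  transferred-kind : ∀ {m s} x → S.matched x ≡ m → S.side x ≡ s →
    U.matched (transfer S U m s x) ≡ m × U.side (transfer S U m s x) ≡ s
  transferred-kind {m} {s} x mx sx =
    U.ofKind-sound m s _ (transfer-kind m s x (S.ofKind-complete mx sx))

  relabelBy-kind : ∀ {m s} x → S.matched x ≡ m → S.side x ≡ s →
    U.matched (relabelBy S U m s x) ≡ m × U.side (relabelBy S U m s x) ≡ s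
  relabelBy-kind {true} {false} x mx sx =
    trans (U.matched-partner y) (proj₁ y-kind) ,
    trans (U.side-partner (proj₁ y-kind)) (cong not (proj₂ y-kind))
    where
    y : Fin (suc n)
    y = transfer S U true true (S.partner x)
    y-kind : U.matched y ≡ true × U.side y ≡ true
    y-kind = transferred-kind (S.partner x)
      (trans (S.matched-partner x) mx) (trans (S.side-partner mx) (cong not sx))
  relabelBy-kind {true} {true} x mx sx = transferred-kind x mx sx
  relabelBy-kind {false} x mx sx = transferred-kind x mx sx

  relabel-kind : ∀ x → U.matched (relabel S U x) ≡ S.matched x × U.side (relabel S U x) ≡ S.side x
  relabel-kind x = relabelBy-kind x refl refl

  relabel-on : ∀ {m s x} → S.matched x ≡ m → S.side x ≡ s → relabel S U x ≡ relabelBy S U m s x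
  relabel-on {x = x} mx sx = cong₂ (λ m s → relabelBy S U m s x) mx sx

  relabelBy-inverse : ∀ {m s} x → S.matched x ≡ m → S.side x ≡ s →
    relabelBy U S m s (relabelBy S U m s x) ≡ x
  relabelBy-inverse {true} {false} x mx sx =
    trans (cong (λ z → S.partner (transfer U S true true z)) (U.partner-involutive _))
      (trans (cong S.partner (transfer-inverse true true (S.partner x)
               (S.ofKind-complete (trans (S.matched-partner x) mx)
                                  (trans (S.side-partner mx) (cong not sx)))))
             (S.partner-involutive x))
  relabelBy-inverse {true} {true} x mx sx = transfer-inverse true true x (S.ofKind-complete mx sx)
  relabelBy-inverse {false} {s} x mx sx = transfer-inverse false s x (S.ofKind-complete mx sx)

  relabel-inverse : ∀ x → relabel U S (relabel S U x) ≡ x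
  relabel-inverse x =
    trans (cong₂ (λ m s → relabelBy U S m s (relabel S U x))
                 (proj₁ (relabel-kind x)) (proj₂ (relabel-kind x)))
          (relabelBy-inverse x refl refl)

  relabel-partner : ∀ x → U.partner (relabel S U x) ≡ relabel S U (S.partner x)
  relabel-partner x = by-kind (S.matched x) (S.side x) refl refl
    where
    by-kind : ∀ m s → S.matched x ≡ m → S.side x ≡ s →
      U.partner (relabel S U x) ≡ relabel S U (S.partner x)
    by-kind false s mx sx = trans (U.unmatched⇒fixed (trans (proj₁ (relabel-kind x)) mx))
                                  (cong (relabel S U) (sym (S.unmatched⇒fixed mx)))
    by-kind true s mx sx with relabel-on {x = S.partner x} (trans (S.matched-partner x) mx)
                                                          (trans (S.side-partner mx) (cong not sx))
    by-kind true true mx sx | partner-relabelled =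
      trans (cong U.partner (relabel-on mx sx))
        (sym (trans partner-relabelled
          (cong (λ z → U.partner (transfer S U true true z)) (S.partner-involutive x))))
    by-kind true false mx sx | partner-relabelled =
      trans (cong U.partner (relabel-on mx sx))
        (trans (U.partner-involutive _) (sym partner-relabelled))

sameKindCounts⇒isometric : ∀ {n} {S U : Structure (suc n)} → SameKindCounts S U →
  Isometric (distance S) (distance U)
sameKindCounts⇒isometric {S = S} {U} same =
  permutation (relabel S U) (relabel U S) (Relabel.relabel-inverse U S (λ m s → sym (same m s)))
    relabel-inverse ,
  distance-preserved S U (relabel S U) injective (proj₂ ∘ relabel-kind) relabel-partner
  where
  open Relabel S U same
  injective : ∀ {x y} → relabel S U x ≡ relabel S U y → x ≡ y
  injective {x} {y} eq =
    trans (sym (relabel-inverse x)) (trans (cong (relabel U S) eq) (relabel-inverse y))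

module _ {n : ℕ} {S U : Structure (suc n)} where
  private
    module S where
      open Structure S public
      open KindProperties S public
      open DistanceProperties S public
    module U where
      open Structure U public
      open KindProperties U public
      open DistanceProperties U public

  isometric⇒sameKindCounts : Isometric (distance S) (distance U) →
    ∃[ c ] SameKindCounts (flipSides c S) U
  isometric⇒sameKindCounts (π , preserves) =
    c , λ m s → count-bijection (ofKind (flipSides c S) m s) (ofKind U m s) (π ⟨$⟩ʳ_) (π ⟨$⟩ˡ_)
                  (λ _ → inverseˡ π) (λ _ → inverseʳ π)
                  (λ x → cong₂ (λ u v → (m ≐ u) ∧ (s ≐ v)) (matched-π x) (side-π x))
    where
    c : Bool
    c = S.side zero xor U.side (π ⟨$⟩ʳ zero)
    side-π : ∀ x → U.side (π ⟨$⟩ʳ x) ≡ c xor S.side x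
    side-π x = xor-transport (S.side x) (S.side zero) (U.side (π ⟨$⟩ʳ x)) (U.side (π ⟨$⟩ʳ zero))
      (trans (sym (U.odd-distance _ _)) (trans (cong odd (preserves x zero)) (S.odd-distance x zero)))
    matched-π : ∀ x → U.matched (π ⟨$⟩ʳ x) ≡ S.matched x
    matched-π x = ⇔→≡ (mk⇔ to from)
      where
      to : U.matched (π ⟨$⟩ʳ x) ≡ true → S.matched x ≡ true
      to mπx = S.three⇒matched x y (trans (sym (preserves x y))
        (trans (cong (distance U (π ⟨$⟩ʳ x)) (inverseʳ π)) (U.matched⇒three (π ⟨$⟩ʳ x) mπx)))
        where
        y : Fin (suc n)
        y = π ⟨$⟩ˡ U.partner (π ⟨$⟩ʳ x)
      from : S.matched x ≡ true → U.matched (π ⟨$⟩ʳ x) ≡ true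
      from mx = U.three⇒matched _ _ (trans (preserves x (S.partner x)) (S.matched⇒three x mx))

  sameShape⇒isometric : SameShape S U → Isometric (distance S) (distance U)
  sameShape⇒isometric shape with sameShape⇒sameKindCounts {S = S} {U} shape
  ... | c , same = Isometric-resp {e₁ = distance U} (distance-flipSides c S) (λ _ _ → refl)
                     (sameKindCounts⇒isometric {S = flipSides c S} {U} same)

isometric⇒sameShape : ∀ {n} {S U : Structure n} → Isometric (distance S) (distance U) → SameShape S U
isometric⇒sameShape {zero} _ = refl , refl , refl
isometric⇒sameShape {suc n} {S} {U} iso with isometric⇒sameKindCounts {S = S} {U} iso
... | c , same = sameKindCounts⇒sameShape {S = S} {U} c same

emptyStructure : Structure 0
emptyStructure = record
  { side = λ () ; partner = λ () ; partner-involutive = λ () ; partner-crosses = λ () }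

addPoint : ∀ {n} → Bool → Structure n → Structure (suc n)
addPoint {n} s S = record
  { side = side′ ; partner = partner′ ; partner-involutive = involutive ; partner-crosses = crosses }
  where
  open Structure S
  side′ : Fin (suc n) → Bool
  side′ zero = s
  side′ (suc x) = side x
  partner′ : Fin (suc n) → Fin (suc n)
  partner′ zero = zero
  partner′ (suc x) = suc (partner x)
  involutive : ∀ x → partner′ (partner′ x) ≡ x
  involutive zero = refl
  involutive (suc x) = cong suc (partner-involutive x)
  crosses : ∀ x → partner′ x ≢ x → side′ x xor side′ (partner′ x) ≡ true
  crosses zero moved = ⊥-elim (moved refl)
  crosses (suc x) moved = partner-crosses x (moved ∘ cong suc)

addPair : ∀ {n} → Structure n → Structure (suc (suc n))
addPair {n} S = record
  { side = side′ ; partner = partner′ ; partner-involutive = involutive ; partner-crosses = crosses }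
  where
  open Structure S
  side′ : Fin (suc (suc n)) → Bool
  side′ zero = true
  side′ (suc zero) = false
  side′ (suc (suc x)) = side x
  partner′ : Fin (suc (suc n)) → Fin (suc (suc n))
  partner′ zero = suc zero
  partner′ (suc zero) = zero
  partner′ (suc (suc x)) = suc (suc (partner x))
  involutive : ∀ x → partner′ (partner′ x) ≡ x
  involutive zero = refl
  involutive (suc zero) = refl
  involutive (suc (suc x)) = cong (λ y → suc (suc y)) (partner-involutive x)
  crosses : ∀ x → partner′ x ≢ x → side′ x xor side′ (partner′ x) ≡ true
  crosses zero _ = refl
  crosses (suc zero) _ = refl
  crosses (suc (suc x)) moved = partner-crosses x (moved ∘ cong (λ y → suc (suc y)))

-- Indexing by m * 2 makes suc m * 2 + r reduce to suc (suc (m * 2 + r)).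
canonical : ∀ m b a → Structure (m * 2 + (b + a))
canonical (suc m) b a = addPair (canonical m b a)
canonical zero (suc b) a = addPoint false (canonical zero b a)
canonical zero zero (suc a) = addPoint true (canonical zero zero a)
canonical zero zero zero = emptyStructure

canonical-pairs : ∀ m b a → pairs (canonical m b a) ≡ m
canonical-pairs (suc m) b a = cong suc (canonical-pairs m b a)
canonical-pairs zero (suc b) a = canonical-pairs zero b a
canonical-pairs zero zero (suc a) = canonical-pairs zero zero a
canonical-pairs zero zero zero = refl

canonical-unmatchedOn : ∀ m b a → kindCount (canonical m b a) false false ≡ b ×
                                  kindCount (canonical m b a) false true ≡ a
canonical-unmatchedOn (suc m) b a = canonical-unmatchedOn m b a
canonical-unmatchedOn zero (suc b) a = map₁ (cong suc) (canonical-unmatchedOn zero b a)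
canonical-unmatchedOn zero zero (suc a) = map₂ (cong suc) (canonical-unmatchedOn zero zero a)
canonical-unmatchedOn zero zero zero = refl , refl

kindCount-subst : ∀ {n n′} (eq : n ≡ n′) (S : Structure n) m s →
  kindCount (subst Structure eq S) m s ≡ kindCount S m s
kindCount-subst refl S m s = refl

canonical-size : ∀ N m b → m * 2 + b ≤ N → m * 2 + (b + (N ∸ (m * 2 + b))) ≡ N
canonical-size N m b fits = trans (sym (+-assoc (m * 2) b _)) (m+[n∸m]≡n fits)

canonicalOn : ∀ N m b → m * 2 + b ≤ N → Structure N
canonicalOn N m b fits = subst Structure (canonical-size N m b fits) (canonical m b (N ∸ (m * 2 + b)))

module _ (N m b : ℕ) (fits : m * 2 + b + b ≤ N) where
  private
    a : ℕ
    a = N ∸ (m * 2 + b)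
    fits′ : m * 2 + b ≤ N
    fits′ = m+n≤o⇒m≤o (m * 2 + b) fits
    kindCount≡ : ∀ m′ s → kindCount (canonicalOn N m b fits′) m′ s ≡ kindCount (canonical m b a) m′ s
    kindCount≡ = kindCount-subst (canonical-size N m b fits′) (canonical m b a)

  canonicalOn-pairs : pairs (canonicalOn N m b fits′) ≡ m
  canonicalOn-pairs = trans (kindCount≡ true true) (canonical-pairs m b _)

  canonicalOn-smallerSide : smallerSide (canonicalOn N m b fits′) ≡ b
  canonicalOn-smallerSide =
    trans (cong₂ _⊓_ (trans (kindCount≡ false true) (proj₂ (canonical-unmatchedOn m b a)))
                     (trans (kindCount≡ false false) (proj₁ (canonical-unmatchedOn m b a))))
          (m≥n⇒m⊓n≡n (m+n≤o⇒m≤o∸n b (subst (_≤ N) (+-comm (m * 2 + b) b) fits)))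

module Satisfaction {n : ℕ} (S : Structure (suc n)) where
  open Structure S
  open KindProperties S
  open DistanceProperties S

  distance-sat4 : ∀ p → p ≤ pairs S → Sat p φ4 (distance S)
  distance-sat4 p p≤pairs = u , v , u-injective , v-injective , three
    where
    P : Fin (suc n) → Bool
    P = ofKind S true true
    in-range : (i : Fin p) → toℕ i < count P
    in-range i = <-≤-trans (toℕ<n i) p≤pairs
    u v : Fin p → Fin (suc n)
    u i = select P (toℕ i)
    v i = partner (u i)
    u-injective : ∀ {i j} → u i ≡ u j → i ≡ j
    u-injective {i} {j} eq = toℕ-injective (select-injective P (in-range i) (in-range j) eq)
    v-injective : ∀ {i j} → v i ≡ v j → i ≡ j
    v-injective eq = u-injective (partner-injective eq)
    three : ∀ i → distance S (u i) (v i) ≡ 3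
    three i = matched⇒three (u i) (proj₁ (ofKind-sound true true (u i) (select-holds P (in-range i))))

  distance-sat5 : ∀ p → p + p ≤ unmatched S → Sat p φ5 (distance S)
  distance-sat5 p 2p≤unmatched =
    u , v , u-injective , v-injective , u≢v ,
    (λ i w → unmatched-distance (u-unmatched i)) , (λ i w → unmatched-distance (v-unmatched i))
    where
    P : Fin (suc n) → Bool
    P = not ∘ matched
    2p≤count : p + p ≤ count P
    2p≤count = subst (p + p ≤_) (sym count-unmatched) 2p≤unmatched
    u-range : (i : Fin p) → toℕ i < count P
    u-range i = <-≤-trans (toℕ<n i) (≤-trans (m≤m+n p p) 2p≤count)
    v-range : (i : Fin p) → p + toℕ i < count P
    v-range i = <-≤-trans (+-monoʳ-< p (toℕ<n i)) 2p≤count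
    u v : Fin p → Fin (suc n)
    u i = select P (toℕ i)
    v i = select P (p + toℕ i)
    not≡true : ∀ {b} → not b ≡ true → b ≡ false
    not≡true {false} _ = refl
    u-unmatched : ∀ i → matched (u i) ≡ false
    u-unmatched i = not≡true (select-holds P (u-range i))
    v-unmatched : ∀ i → matched (v i) ≡ false
    v-unmatched i = not≡true (select-holds P (v-range i))
    u-injective : ∀ {i j} → u i ≡ u j → i ≡ j
    u-injective {i} {j} eq = toℕ-injective (select-injective P (u-range i) (u-range j) eq)
    v-injective : ∀ {i j} → v i ≡ v j → i ≡ j
    v-injective {i} {j} eq =
      toℕ-injective (+-cancelˡ-≡ p _ _ (select-injective P (v-range i) (v-range j) eq))
    u≢v : ∀ i j → u i ≢ v j
    u≢v i j eq = <⇒≢ (<-≤-trans (toℕ<n i) (m≤m+n p (toℕ j)))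
                      (select-injective P (u-range i) (v-range j) eq)

module ClassMember {n : ℕ} (d : Dist (suc n)) (C : InClass d) where
  open FromClass d C public

  sat1 : ∀ p → Sat p φ1 d
  sat1 p = d-In123

  sat2 : ∀ p → Sat p φ2 d
  sat2 p x y z y≢z (dxy≡3 , dxz≡3) = no-two-threes y≢z dxy≡3 dxz≡3

  sat3 : ∀ p → Sat p φ3 d
  sat3 p x y z x≢y y≢z x≢z = triangle⇒φ3 (d-triangle x y z x≢y y≢z x≢z)

  sat4 : ∀ p → p ≤ pairs structure → Sat p φ4 d
  sat4 p p≤pairs with Satisfaction.distance-sat4 structure p p≤pairs
  ... | u , v , u-injective , v-injective , three =
    u , v , u-injective , v-injective , λ i → trans (d≗distance _ _) (three i)

  sat5 : ∀ p → p + p ≤ unmatched structure → Sat p φ5 d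
  sat5 p 2p≤unmatched with Satisfaction.distance-sat5 structure p 2p≤unmatched
  ... | u , v , u-injective , v-injective , u≢v , u-near , v-near =
    u , v , u-injective , v-injective , u≢v , transport u-near , transport v-near
    where
    transport : ∀ {f : Fin p → Fin (suc n)} →
      (∀ i w → w ≢ f i → distance structure (f i) w ≢ 2 → distance structure (f i) w ≡ 1) →
      (∀ i w → w ≢ f i → d (f i) w ≢ 2 → d (f i) w ≡ 1)
    transport near i w w≢ d≢2 =
      trans (d≗distance _ _) (near i w w≢ (d≢2 ∘ trans (d≗distance _ _)))

sameShape⇒isometric-class : ∀ {n} {d d′ : Dist (suc n)} (C : InClass d) (C′ : InClass d′) →
  SameShape (ClassMember.structure d C) (ClassMember.structure d′ C′) → Isometric d d′
sameShape⇒isometric-class {d = d} {d′} C C′ shape =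
  Isometric-resp (λ x y → sym (ClassMember.d≗distance d C x y))
                 (λ x y → sym (ClassMember.d≗distance d′ C′ x y))
    (sameShape⇒isometric {S = ClassMember.structure d C} {ClassMember.structure d′ C′} shape)

-- Counting isometry classes

AllPairs-resp-⊆ : ∀ {A : Set} {R : A → A → Set} {xs ys : List A} → xs ⊆ ys →
  AllPairs R ys → AllPairs R xs
AllPairs-resp-⊆ [] [] = []
AllPairs-resp-⊆ (_ ∷ʳ xs⊆ys) (_ ∷ rys) = AllPairs-resp-⊆ xs⊆ys rys
AllPairs-resp-⊆ (refl ∷ xs⊆ys) (rx ∷ rys) = All-resp-⊆ xs⊆ys rx ∷ AllPairs-resp-⊆ xs⊆ys rys

AllPairs-lookup : ∀ {A : Set} {R : A → A → Set} {xs : List A} → AllPairs R xs →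
  ∀ i j → toℕ i < toℕ j → R (lookup xs i) (lookup xs j)
AllPairs-lookup (rx ∷ _) zero (suc j) _ = All.lookup rx (∈-lookup j)
AllPairs-lookup (_ ∷ rxs) (suc i) (suc j) (s≤s i<j) = AllPairs-lookup rxs i j i<j

length≤keys : ∀ {A : Set} {R : A → A → Set} {Q : A → Set} {K} (xs : List A) →
  AllPairs (λ a b → ¬ R a b) xs → All Q xs → (key : ∀ a → Q a → Fin K) →
  (∀ a b qa qb → key a qa ≡ key b qb → R a b) → length xs ≤ K
length≤keys {Q = Q} xs unrelated qs key related = injective⇒≤ injective
  where
  q : ∀ i → Q (lookup xs i)
  q i = All.lookup qs (∈-lookup i)
  injective : ∀ {i j} → key _ (q i) ≡ key _ (q j) → i ≡ j
  injective {i} {j} eq with <-cmp (toℕ i) (toℕ j)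
  ... | tri< i<j _ _ = ⊥-elim (AllPairs-lookup unrelated i j i<j (related _ _ _ _ eq))
  ... | tri≈ _ i≡j _ = toℕ-injective i≡j
  ... | tri> _ _ j<i = ⊥-elim (AllPairs-lookup unrelated j i j<i (related _ _ _ _ (sym eq)))

transversal-length : ∀ {N} {reps : List (Dist N)} → Transversal N reps →
  ∀ {K} (f : Fin K → Dist N) → (∀ i → InClass (f i)) →
  (∀ i j → Isometric (f i) (f j) → i ≡ j) → K ≤ length reps
transversal-length {reps = reps} (_ , covers , _) f inClass rigid = injective⇒≤ injective
  where
  representative : ∀ i → Any (Isometric (f i)) reps
  representative i = covers (f i) (inClass i)
  injective : ∀ {i j} → index (representative i) ≡ index (representative j) → i ≡ j
  injective {i} {j} eq = rigid i j (Isometric-trans {d′ = lookup reps (index (representative i))} {f j}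
    (lookup-index (representative i))
    (Isometric-sym {d = f j}
      (subst (λ k → Isometric (f j) (lookup reps k)) (sym eq) (lookup-index (representative j)))))

module _ {n : ℕ} (p : ℕ) where
  private
    Bad : Sentence → Dist (suc n) → Set
    Bad φ d = InClass d × ¬ Sat p φ d
    module M (d : Dist (suc n)) (C : InClass d) = ClassMember {n} d C

  badCount : Sentence → ℕ
  badCount φ4 = p * suc (suc n)
  badCount φ5 = (p + p) * (p + p)
  badCount _ = 0

  no-bad : ∀ φ → (∀ d → InClass d → Sat p φ d) → (bad : List (Dist (suc n))) → All (Bad φ) bad →
    length bad ≤ 0
  no-bad φ always [] [] = z≤n
  no-bad φ always (d ∷ _) ((C , ¬sat) ∷ _) = ⊥-elim (¬sat (always d C))

  bad-length : ∀ φ (bad : List (Dist (suc n))) → AllPairs (λ d d′ → ¬ Isometric d d′) bad →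
    All (Bad φ) bad → length bad ≤ badCount φ
  bad-length φ1 bad _ bads = no-bad φ1 (λ d C → M.sat1 d C p) bad bads
  bad-length φ2 bad _ bads = no-bad φ2 (λ d C → M.sat2 d C p) bad bads
  bad-length φ3 bad _ bads = no-bad φ3 (λ d C → M.sat3 d C p) bad bads
  bad-length φ4 bad unrelated bads = length≤keys bad unrelated bads key related
    where
    pairs<p : ∀ d ((C , _) : Bad φ4 d) → pairs (M.structure d C) < p
    pairs<p d (C , ¬sat) = ≰⇒> (¬sat ∘ M.sat4 d C p)
    byPairs : ∀ d → Bad φ4 d → Fin p
    byPairs d bad = fromℕ< (pairs<p d bad)
    bySmallerSide : ∀ d → Bad φ4 d → Fin (suc (suc n))
    bySmallerSide d (C , _) = fromℕ< (KindProperties.smallerSide<size (M.structure d C))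
    key : ∀ d → Bad φ4 d → Fin (p * suc (suc n))
    key d bad = combine (byPairs d bad) (bySmallerSide d bad)
    related : ∀ d d′ bad bad′ → key d bad ≡ key d′ bad′ → Isometric d d′
    related d d′ bad@(C , _) bad′@(C′ , _) eq =
      sameShape⇒isometric-class C C′ (sameShape-fromPairs {S = M.structure d C} {M.structure d′ C′}
        (fromℕ<-injective _ _ _ _ (proj₁ same)) (fromℕ<-injective _ _ _ _ (proj₂ same)))
      where
      same : byPairs d bad ≡ byPairs d′ bad′ × bySmallerSide d bad ≡ bySmallerSide d′ bad′
      same = combine-injective (byPairs d bad) (bySmallerSide d bad)
                               (byPairs d′ bad′) (bySmallerSide d′ bad′) eq
  bad-length φ5 bad unrelated bads = length≤keys bad unrelated bads key related
    where
    unmatched<2p : ∀ d ((C , _) : Bad φ5 d) → unmatched (M.structure d C) < p + p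
    unmatched<2p d (C , ¬sat) = ≰⇒> (¬sat ∘ M.sat5 d C p)
    byUnmatched bySmallerSide : ∀ d → Bad φ5 d → Fin (p + p)
    byUnmatched d bad = fromℕ< (unmatched<2p d bad)
    bySmallerSide d bad = fromℕ< (≤-<-trans (m⊓n≤m+n _ _) (unmatched<2p d bad))
    key : ∀ d → Bad φ5 d → Fin ((p + p) * (p + p))
    key d bad = combine (byUnmatched d bad) (bySmallerSide d bad)
    related : ∀ d d′ bad bad′ → key d bad ≡ key d′ bad′ → Isometric d d′
    related d d′ bad@(C , _) bad′@(C′ , _) eq =
      sameShape⇒isometric-class C C′ (sameShape-fromUnmatched {S = M.structure d C} {M.structure d′ C′}
        (fromℕ<-injective _ _ _ _ (proj₁ same)) (fromℕ<-injective _ _ _ _ (proj₂ same)))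
      where
      same : byUnmatched d bad ≡ byUnmatched d′ bad′ × bySmallerSide d bad ≡ bySmallerSide d′ bad′
      same = combine-injective (byUnmatched d bad) (bySmallerSide d bad)
                               (byUnmatched d′ bad′) (bySmallerSide d′ bad′) eq

  badCount≤ : ∀ φ → badCount φ ≤ (p + (p + p) * (p + p)) * suc (suc n)
  badCount≤ φ1 = z≤n
  badCount≤ φ2 = z≤n
  badCount≤ φ3 = z≤n
  badCount≤ φ4 = *-monoˡ-≤ (suc (suc n)) (m≤m+n p _)
  badCount≤ φ5 = ≤-trans (m≤n+m _ p) (m≤m*n _ (suc (suc n)))

reps-lower-bound : ∀ {N} {reps : List (Dist N)} → Transversal N reps → ∀ q → q * 4 ≤ N →
  q * q ≤ length reps
reps-lower-bound {N} transversal q 4q≤N =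
  transversal-length transversal family
    (λ i → DistanceProperties.distance-inClass (member (remQuot q i))) rigid
  where
  open +-*-Solver
  fits : (m b : Fin q) → toℕ m * 2 + toℕ b + toℕ b ≤ N
  fits m b = ≤-trans (+-mono-≤ (+-mono-≤ (*-monoˡ-≤ 2 (<⇒≤ (toℕ<n m))) (<⇒≤ (toℕ<n b))) (<⇒≤ (toℕ<n b)))
                     (subst (_≤ N) (solve 1 (λ q → q :* con 4 := q :* con 2 :+ q :+ q) refl q) 4q≤N)
  member : Fin q × Fin q → Structure N
  member (m , b) = canonicalOn N (toℕ m) (toℕ b) (m+n≤o⇒m≤o (toℕ m * 2 + toℕ b) (fits m b))
  family : Fin (q * q) → Dist N
  family i = distance (member (remQuot q i))
  member-determined : ∀ mb mb′ → SameShape (member mb) (member mb′) → mb ≡ mb′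
  member-determined (m , b) (m′ , b′) (pairs≡ , _ , smaller≡) = cong₂ _,_
    (toℕ-injective (trans (sym (canonicalOn-pairs N (toℕ m) (toℕ b) (fits m b)))
                          (trans pairs≡ (canonicalOn-pairs N (toℕ m′) (toℕ b′) (fits m′ b′)))))
    (toℕ-injective (trans (sym (canonicalOn-smallerSide N (toℕ m) (toℕ b) (fits m b)))
                          (trans smaller≡ (canonicalOn-smallerSide N (toℕ m′) (toℕ b′) (fits m′ b′)))))
  rigid : ∀ i j → Isometric (family i) (family j) → i ≡ j
  rigid i j iso = trans (sym (combine-remQuot {q} q i))
    (trans (cong (uncurry combine) (member-determined (remQuot q i) (remQuot q j)
              (isometric⇒sameShape {S = member (remQuot q i)} {member (remQuot q j)} iso)))
           (combine-remQuot {q} q j))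

linear<quadratic : ∀ k C N → suc (suc k * (C * 4)) * 4 ≤ N → suc k * (C * suc N) < (N / 4) * (N / 4)
linear<quadratic k C N large = begin-strict
  suc k * (C * suc N)        ≤⟨ *-monoʳ-≤ (suc k) (*-monoʳ-≤ C suc-N≤) ⟩
  suc k * (C * (suc q * 4))  ≡⟨ solve 3 (λ k C q → (con 1 :+ k) :* (C :* ((con 1 :+ q) :* con 4))
                                         := (con 1 :+ k) :* (C :* con 4) :* (con 1 :+ q)) refl k C q ⟩
  K * suc q                  ≡⟨ *-suc K q ⟩
  K + K * q                  <⟨ +-monoˡ-< (K * q) K<q ⟩
  q + K * q                  ≤⟨ *-monoˡ-≤ q K<q ⟩
  q * q                      ∎
  where
  open ≤-Reasoning
  open +-*-Solver
  K q : ℕ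
  K = suc k * (C * 4)
  q = N / 4
  K<q : K < q
  K<q = subst (_≤ q) (m*n/n≡m (suc K) 4) (/-monoˡ-≤ 4 large)
  suc-N≤ : suc N ≤ suc q * 4
  suc-N≤ = begin
    suc N                ≡⟨ cong suc (m≡m%n+[m/n]*n N 4) ⟩
    suc (N % 4) + q * 4  ≤⟨ +-monoˡ-≤ (q * 4) (m%n<n N 4) ⟩
    suc q * 4            ∎

lemma4p1 : (p : ℕ) (φ : Sentence) (k : ℕ) →
    ∃[ N ] (∀ (n : ℕ) → N ≤ n → (reps : List (Dist n)) → Transversal n reps →
      (bad : List (Dist n)) → bad ⊆ reps → All (λ d → ¬ Sat p φ d) bad →
      suc k * length bad < length reps)
lemma4p1 p φ k = suc (suc k * (C * 4)) * 4 , bound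
  where
  C : ℕ
  C = p + (p + p) * (p + p)
  bound : ∀ n → suc (suc k * (C * 4)) * 4 ≤ n → (reps : List (Dist n)) → Transversal n reps →
    (bad : List (Dist n)) → bad ⊆ reps → All (λ d → ¬ Sat p φ d) bad →
    suc k * length bad < length reps
  bound (suc n) large reps transversal@(inClass , _ , unrelated) bad bad⊆reps unsat = begin-strict
    suc k * length bad         ≤⟨ *-monoʳ-≤ (suc k) (≤-trans bad-bound (badCount≤ p φ)) ⟩
    suc k * (C * suc (suc n))  <⟨ linear<quadratic k C (suc n) large ⟩
    (suc n / 4) * (suc n / 4)  ≤⟨ reps-lower-bound transversal (suc n / 4) (m/n*n≤m (suc n) 4) ⟩
    length reps                ∎
    where
    open ≤-Reasoning
    bad-bound : length bad ≤ badCount {n} p φ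
    bad-bound = bad-length p φ bad (AllPairs-resp-⊆ bad⊆reps unrelated)
                  (All.zip (All-resp-⊆ bad⊆reps inClass , unsat))
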